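{- Let $G$ be a finite simple connected graph, and for a vertex $v$ let $d_T(v)=\sum_{T}\deg_T v$, the sum over all spanning trees $T$ of $G$ of the degree of $v$ in $T$. If the constant valuation $f\equiv 1$ maximizes $\tau(G)_f$ over $C(G)$, then for any two vertices $v$ and $w$, $$\frac{d_T(v)}{\deg v}=\frac{d_T(w)}{\deg w}.$$
   Context: $P(G)=\{f:E(G)\to(0,\infty) : \sum_{e} f(e)=|E(G)|\}$; $C(G)=\{f\in P(G): \exists\, g:V(G)\to(0,\infty),\ f(e_{vw})=g(v)+g(w) \text{ for each edge } e_{vw}\}$ (the constant valuation $f\equiv1$ belongs to $C(G)$). $\tau(G)_f=\sum_{T}\prod_{e\in E(T)} f(e)$ over spanning trees $T$ of $G$. $\deg v$ is the degree of $v$ in $G$. -}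

module Defs where

open import Data.Nat as ℕ using (ℕ; zero; suc)
open import Data.Fin using (Fin)
open import Data.Fin.Subset using (Subset; _∈_; _∉_; ⊤; _-_)
open import Data.Vec using (lookup)
open import Data.Bool using (Bool; true; false; if_then_else_)
import Data.Bool
open import Data.Product using (_×_; _,_; proj₁; proj₂; ∃)
open import Data.Sum using (_⊎_)
open import Data.List using (List; []; _∷_; foldr; map; filter; length)
open import Data.List.Relation.Unary.Unique.Propositional using (Unique)
import Data.List.Membership.Propositional as LM
open import Data.Integer using (+_)
open import Data.Rational as ℚ using (ℚ; 0ℚ; 1ℚ; _+_; _*_; _<_; _≤_)
open import Data.Fin using (_≟_)
open import Relation.Nullary using (¬_; Dec; yes; no)
open import Relation.Binary.PropositionalEquality using (_≡_; _≢_)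
open import Data.Vec.Functional using () renaming (Vector to Vec)
open import Data.List using (allFin)

record Graph (n m : ℕ) : Set where
  field
    ends       : Fin m → Fin n × Fin n
    loopless   : ∀ e → proj₁ (ends e) ≢ proj₂ (ends e)
    noParallel : ∀ e e' →
                 (ends e ≡ ends e' ⊎
                  (proj₁ (ends e) ≡ proj₂ (ends e') × proj₂ (ends e) ≡ proj₁ (ends e'))) →
                 e ≡ e'
open Graph public

module _ {n m : ℕ} (G : Graph n m) where

  Joins : Fin m → Fin n → Fin n → Set
  Joins e u w = (proj₁ (ends G e) ≡ u × proj₂ (ends G e) ≡ w)
              ⊎ (proj₁ (ends G e) ≡ w × proj₂ (ends G e) ≡ u)

  data Reach (S : Subset m) : Fin n → Fin n → Set where
    here : ∀ {u} → Reach S u u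
    step : ∀ {u x w} (e : Fin m) → e ∈ S → Joins e u x → Reach S x w → Reach S u w

  Connected : Set
  Connected = ∀ u w → Reach ⊤ u w

  -- S is a spanning tree: connected on all vertices, and acyclic
  -- (no edge of S lies on a cycle of S, i.e. removing it disconnects its ends)
  IsSpanningTree : Subset m → Set
  IsSpanningTree S =
    (∀ u w → Reach S u w) ×
    (∀ e → e ∈ S → ¬ Reach (S - e) (proj₁ (ends G e)) (proj₂ (ends G e)))

  TreeEnumeration : List (Subset m) → Set
  TreeEnumeration Ts = Unique Ts × (∀ S → (S LM.∈ Ts → IsSpanningTree S) × (IsSpanningTree S → S LM.∈ Ts))

  incident : Fin n → Fin m → Bool
  incident v e with proj₁ (ends G e) ≟ v | proj₂ (ends G e) ≟ v
  ... | yes _ | _     = true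
  ... | no _  | yes _ = true
  ... | no _  | no _  = false

  deg : Fin n → ℕ
  deg v = length (filter (λ e → Data.Bool._≟_ (incident v e) true) (allFin m))

  degIn : Subset m → Fin n → ℕ
  degIn S v = length (filter (λ e → Data.Bool._≟_ (incident v e ∧' lookup S e) true) (allFin m))
    where
    _∧'_ : Bool → Bool → Bool
    true ∧' b = b
    false ∧' _ = false

  dT : List (Subset m) → Fin n → ℕ
  dT Ts v = foldr (λ S acc → degIn S v ℕ.+ acc) 0 Ts

  sumℚ : List ℚ → ℚ
  sumℚ = foldr _+_ 0ℚ

  ℕ→ℚ : ℕ → ℚ
  ℕ→ℚ k = + k ℚ./ 1

  InP : (Fin m → ℚ) → Set
  InP f = (∀ e → 0ℚ < f e) × sumℚ (map f (allFin m)) ≡ ℕ→ℚ m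

  InC : (Fin m → ℚ) → Set
  InC f = InP f × ∃ λ (g : Fin n → ℚ) → (∀ v → 0ℚ < g v) ×
            (∀ e → f e ≡ g (proj₁ (ends G e)) + g (proj₂ (ends G e)))

  prodOver : (Fin m → ℚ) → Subset m → ℚ
  prodOver f S = foldr (λ e acc → (if lookup S e then f e else 1ℚ) * acc) 1ℚ (allFin m)

  τ : List (Subset m) → (Fin m → ℚ) → ℚ
  τ Ts f = sumℚ (map (prodOver f) Ts)

-- Perturb the constant valuation inside C(G): give the vertices the weights ½ + ε h with
-- h = deg w · [v] - deg v · [w]. The edge valuation is then 1 + ε x with
-- x(e) = deg w · [v ∈ e] - deg v · [w ∈ e], and Σ x = deg w · deg v - deg v · deg w = 0,
-- so it lies in C(G) for small ε > 0. Expanding the product over each tree,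
-- τ(1 + ε x) = τ(1) + ε (deg w · d_T(v) - deg v · d_T(w)) + O(ε²) with an explicit bound on
-- the remainder; maximality of the constant valuation thus forces
-- deg w · d_T(v) ≤ deg v · d_T(w), and exchanging v and w gives equality.
{-# OPTIONS --safe #-}
module Submission where

open import Defs
open import Data.Nat using (ℕ; _*_)
open import Data.Fin using (Fin)
open import Data.Fin.Subset using (Subset)
open import Data.List using (List)
open import Data.Rational using (ℚ; 1ℚ; _≤_)
open import Relation.Binary.PropositionalEquality using (_≡_)

open import Data.Bool using (Bool; true; false; if_then_else_)
import Data.Bool as Bool
open import Data.Bool.Properties using (if-eta)
open import Data.Empty using (⊥-elim)
import Data.Fin as Fin
import Data.Integer as ℤ
import Data.Integer.Properties as ℤₚ
import Data.Nat as ℕ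
import Data.Nat.Coprimality as Coprimality
import Data.Nat.Properties as ℕₚ
open import Data.List using ([]; _∷_; map; foldr; filter; length; allFin)
open import Data.List.Properties using (map-cong; length-tabulate)
open import Data.Product using (∃; _×_; _,_; proj₁; proj₂)
open import Data.Rational
  using (0ℚ; ½; _+_; _-_; -_; ∣_∣; _<_; 1/_; mkℚ; NonZero; NonNegative; Positive; nonNegative; positive)
  renaming (_*_ to _·_)
open import Data.Rational.Properties
open import Data.Rational.Solver using (module +-*-Solver)
open +-*-Solver using (solve; _:+_; _:*_; _:-_; :-_; _:=_; con)
open import Data.Sum using (inj₁; inj₂)
open import Data.Vec using (lookup)
open import Function using (id)
open import Relation.Binary.PropositionalEquality
  using (refl; sym; trans; cong; cong₂; subst; subst₂; module ≡-Reasoning)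
open import Relation.Nullary using (¬_; does; yes; no)

-- `fromℕ` and `sum` agree definitionally with `ℕ→ℚ G` and `sumℚ G` of Defs,
-- which do not actually depend on the graph G.
fromℕ : ℕ → ℚ
fromℕ k = ℤ.+ k Data.Rational./ 1

sum : List ℚ → ℚ
sum = foldr _+_ 0ℚ

fromℕ-suc : ∀ k → fromℕ (ℕ.suc k) ≡ 1ℚ + fromℕ k
fromℕ-suc k = begin
  fromℕ (ℕ.suc k)              ≡⟨ cong (λ i → (ℤ.+ 1 ℤ.+ i) Data.Rational./ 1) (sym (ℤₚ.*-identityʳ (ℤ.+ k))) ⟩
  1ℚ + mkℚ (ℤ.+ k) 0 coprime   ≡⟨ cong (1ℚ +_) (sym (normalize-coprime coprime)) ⟩
  1ℚ + fromℕ k                 ∎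
  where
  open ≡-Reasoning
  coprime : Coprimality.Coprime k 1
  coprime = Coprimality.sym (Coprimality.1-coprimeTo k)

fromℕ-+ : ∀ j k → fromℕ (j ℕ.+ k) ≡ fromℕ j + fromℕ k
fromℕ-+ ℕ.zero    k = sym (+-identityˡ (fromℕ k))
fromℕ-+ (ℕ.suc j) k = begin
  fromℕ (ℕ.suc (j ℕ.+ k))     ≡⟨ fromℕ-suc (j ℕ.+ k) ⟩
  1ℚ + fromℕ (j ℕ.+ k)        ≡⟨ cong (1ℚ +_) (fromℕ-+ j k) ⟩
  1ℚ + (fromℕ j + fromℕ k)    ≡⟨ sym (+-assoc 1ℚ (fromℕ j) (fromℕ k)) ⟩
  1ℚ + fromℕ j + fromℕ k      ≡⟨ cong (_+ fromℕ k) (sym (fromℕ-suc j)) ⟩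
  fromℕ (ℕ.suc j) + fromℕ k   ∎
  where open ≡-Reasoning

fromℕ-* : ∀ j k → fromℕ (j * k) ≡ fromℕ j · fromℕ k
fromℕ-* ℕ.zero    k = sym (*-zeroˡ (fromℕ k))
fromℕ-* (ℕ.suc j) k = begin
  fromℕ (k ℕ.+ j * k)         ≡⟨ fromℕ-+ k (j * k) ⟩
  fromℕ k + fromℕ (j * k)     ≡⟨ cong (fromℕ k +_) (fromℕ-* j k) ⟩
  fromℕ k + fromℕ j · fromℕ k ≡⟨ solve 2 (λ j k → k :+ j :* k := (con 1ℚ :+ j) :* k) refl (fromℕ j) (fromℕ k) ⟩
  (1ℚ + fromℕ j) · fromℕ k    ≡⟨ cong (_· fromℕ k) (sym (fromℕ-suc j)) ⟩
  fromℕ (ℕ.suc j) · fromℕ k   ∎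
  where open ≡-Reasoning

fromℕ-nonNeg : ∀ k → 0ℚ ≤ fromℕ k
fromℕ-nonNeg k = nonNegative⁻¹ (fromℕ k) {{normalize-nonNeg k 1}}

*-mono-≤-nonNeg : ∀ {p q r s} → 0ℚ ≤ p → 0ℚ ≤ r → p ≤ q → r ≤ s → p · r ≤ q · s
*-mono-≤-nonNeg {p} {q} {r} {s} 0≤p 0≤r p≤q r≤s = ≤-trans
  (*-monoʳ-≤-nonNeg r {{nonNegative 0≤r}} p≤q)
  (*-monoˡ-≤-nonNeg q {{nonNegative (≤-trans 0≤p p≤q)}} r≤s)

0≤p·q : ∀ {p q} → 0ℚ ≤ p → 0ℚ ≤ q → 0ℚ ≤ p · q
0≤p·q {p} {q} 0≤p 0≤q = nonNegative⁻¹ (p · q) {{nonNeg*nonNeg⇒nonNeg p {{nonNegative 0≤p}} q {{nonNegative 0≤q}}}}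

-∣p∣≤p : ∀ p → - ∣ p ∣ ≤ p
-∣p∣≤p p with ∣p∣≡p∨∣p∣≡-p p
... | inj₁ ∣p∣≡p  = ≤-trans (neg-antimono-≤ (0≤∣p∣ p)) (subst (0ℚ ≤_) ∣p∣≡p (0≤∣p∣ p))
... | inj₂ ∣p∣≡-p = ≤-reflexive (trans (cong -_ ∣p∣≡-p) (solve 1 (λ p → :- (:- p) := p) refl p))

p≤p+q : ∀ {p q} → 0ℚ ≤ q → p ≤ p + q
p≤p+q {p} 0≤q = subst (_≤ p + _) (+-identityʳ p) (+-monoʳ-≤ p 0≤q)

q≤p+q : ∀ {p q} → 0ℚ ≤ p → q ≤ p + q
q≤p+q {p} {q} 0≤p = subst (_≤ p + q) (+-identityˡ q) (+-monoˡ-≤ q 0≤p)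

fromℕ-<⇒1≤- : ∀ {j k} → j ℕ.< k → 1ℚ ≤ fromℕ k - fromℕ j
fromℕ-<⇒1≤- {j} {k} j<k = begin
  1ℚ                                  ≤⟨ p≤p+q (fromℕ-nonNeg d) ⟩
  1ℚ + fromℕ d                        ≡⟨ solve 3 (λ o j d → o :+ d := o :+ j :+ d :- j) refl 1ℚ (fromℕ j) (fromℕ d) ⟩
  1ℚ + fromℕ j + fromℕ d - fromℕ j    ≡⟨ cong (λ q → q + fromℕ d - fromℕ j) (sym (fromℕ-suc j)) ⟩
  fromℕ (ℕ.suc j) + fromℕ d - fromℕ j ≡⟨ cong (_- fromℕ j) (sym (fromℕ-+ (ℕ.suc j) d)) ⟩
  fromℕ (ℕ.suc j ℕ.+ d) - fromℕ j     ≡⟨ cong (λ i → fromℕ i - fromℕ j) (ℕₚ.m+[n∸m]≡n j<k) ⟩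
  fromℕ k - fromℕ j                   ∎
  where
  open ≤-Reasoning
  d : ℕ
  d = k ℕ.∸ ℕ.suc j

𝟙 : Bool → ℚ
𝟙 true  = 1ℚ
𝟙 false = 0ℚ

∣𝟙·p∣≤∣p∣ : ∀ t p → ∣ 𝟙 t · p ∣ ≤ ∣ p ∣
∣𝟙·p∣≤∣p∣ true  p = ≤-reflexive (cong ∣_∣ (*-identityˡ p))
∣𝟙·p∣≤∣p∣ false p = subst (_≤ ∣ p ∣) (cong ∣_∣ (sym (*-zeroˡ p))) (0≤∣p∣ p)

0≤𝟙 : ∀ t → 0ℚ ≤ 𝟙 t
0≤𝟙 true  = <⇒≤ (positive⁻¹ 1ℚ)
0≤𝟙 false = ≤-refl

·𝟙≤ : ∀ {p} → 0ℚ ≤ p → ∀ t → p · 𝟙 t ≤ p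
·𝟙≤ {p} 0≤p true  = ≤-reflexive (*-identityʳ p)
·𝟙≤ {p} 0≤p false = subst (_≤ p) (sym (*-zeroʳ p)) 0≤p

module _ {A : Set} where

  sum-map-+ : ∀ (F G : A → ℚ) xs → sum (map (λ x → F x + G x) xs) ≡ sum (map F xs) + sum (map G xs)
  sum-map-+ F G []       = refl
  sum-map-+ F G (x ∷ xs) = trans (cong (F x + G x +_) (sum-map-+ F G xs))
    (solve 4 (λ f g s t → f :+ g :+ (s :+ t) := f :+ s :+ (g :+ t)) refl (F x) (G x) _ _)

  sum-map-- : ∀ (F G : A → ℚ) xs → sum (map (λ x → F x - G x) xs) ≡ sum (map F xs) - sum (map G xs)
  sum-map-- F G []       = refl
  sum-map-- F G (x ∷ xs) = trans (cong (F x - G x +_) (sum-map-- F G xs))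
    (solve 4 (λ f g s t → f :- g :+ (s :- t) := f :+ s :- (g :+ t)) refl (F x) (G x) _ _)

  sum-map-*ˡ : ∀ c (F : A → ℚ) xs → sum (map (λ x → c · F x) xs) ≡ c · sum (map F xs)
  sum-map-*ˡ c F []       = sym (*-zeroʳ c)
  sum-map-*ˡ c F (x ∷ xs) = trans (cong (c · F x +_) (sum-map-*ˡ c F xs)) (sym (*-distribˡ-+ c (F x) _))

  sum-map-1 : ∀ (xs : List A) → sum (map (λ _ → 1ℚ) xs) ≡ fromℕ (length xs)
  sum-map-1 []       = refl
  sum-map-1 (x ∷ xs) = trans (cong (1ℚ +_) (sum-map-1 xs)) (sym (fromℕ-suc (length xs)))

  sum-map-fromℕ : ∀ (F : A → ℕ) xs → sum (map (λ x → fromℕ (F x)) xs) ≡ fromℕ (foldr (λ x k → F x ℕ.+ k) 0 xs)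
  sum-map-fromℕ F []       = refl
  sum-map-fromℕ F (x ∷ xs) = trans (cong (fromℕ (F x) +_) (sum-map-fromℕ F xs)) (sym (fromℕ-+ (F x) _))

  sum-map-𝟙 : ∀ (P : A → Bool) xs → sum (map (λ x → 𝟙 (P x)) xs) ≡ fromℕ (length (filter (λ x → P x Bool.≟ true) xs))
  sum-map-𝟙 P [] = refl
  sum-map-𝟙 P (x ∷ xs) with P x
  ... | true  = trans (cong (1ℚ +_) (sum-map-𝟙 P xs)) (sym (fromℕ-suc (length (filter (λ x → P x Bool.≟ true) xs))))
  ... | false = trans (+-identityˡ _) (sum-map-𝟙 P xs)

  ∣sum-map∣≤ : ∀ {M} (F : A → ℚ) → (∀ x → ∣ F x ∣ ≤ M) → ∀ xs → ∣ sum (map F xs) ∣ ≤ fromℕ (length xs) · M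
  ∣sum-map∣≤ {M} F ∣F∣≤M []       = ≤-reflexive (sym (*-zeroˡ M))
  ∣sum-map∣≤ {M} F ∣F∣≤M (x ∷ xs) = begin
    ∣ F x + sum (map F xs) ∣       ≤⟨ ∣p+q∣≤∣p∣+∣q∣ (F x) _ ⟩
    ∣ F x ∣ + ∣ sum (map F xs) ∣   ≤⟨ +-mono-≤ (∣F∣≤M x) (∣sum-map∣≤ F ∣F∣≤M xs) ⟩
    M + fromℕ k · M                ≡⟨ solve 2 (λ m k → m :+ k :* m := (con 1ℚ :+ k) :* m) refl M (fromℕ k) ⟩
    (1ℚ + fromℕ k) · M             ≡⟨ cong (_· M) (sym (fromℕ-suc k)) ⟩
    fromℕ (ℕ.suc k) · M            ∎
    where
    open ≤-Reasoning
    k : ℕ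
    k = length xs

  sum-map-linear : ∀ α β (F G : A → ℚ) xs →
                   sum (map (λ x → α · F x - β · G x) xs) ≡ α · sum (map F xs) - β · sum (map G xs)
  sum-map-linear α β F G xs =
    trans (sum-map-- (λ x → α · F x) (λ x → β · G x) xs) (cong₂ _-_ (sum-map-*ˡ α F xs) (sum-map-*ˡ β G xs))

  sum-map-1+· : ∀ ε (F : A → ℚ) xs → sum (map (λ x → 1ℚ + ε · F x) xs) ≡ fromℕ (length xs) + ε · sum (map F xs)
  sum-map-1+· ε F xs =
    trans (sum-map-+ (λ _ → 1ℚ) (λ x → ε · F x) xs) (cong₂ _+_ (sum-map-1 xs) (sum-map-*ˡ ε F xs))

remainderBound : ℚ → ℕ → ℚ
remainderBound B ℕ.zero    = 0ℚ
remainderBound B (ℕ.suc k) = fromℕ k · B · B + remainderBound B k · (1ℚ + B)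

remainderBound-nonNeg : ∀ {B} → 0ℚ ≤ B → ∀ k → 0ℚ ≤ remainderBound B k
remainderBound-nonNeg 0≤B ℕ.zero    = ≤-refl
remainderBound-nonNeg 0≤B (ℕ.suc k) = +-mono-≤
  (0≤p·q (0≤p·q (fromℕ-nonNeg k) 0≤B) 0≤B)
  (0≤p·q (remainderBound-nonNeg 0≤B k) (+-mono-≤ (<⇒≤ (positive⁻¹ 1ℚ)) 0≤B))

module _ {A : Set} {ε B : ℚ} (0≤ε : 0ℚ ≤ ε) (ε≤1 : ε ≤ 1ℚ)
         (c y : A → ℚ) (c≡1+εy : ∀ x → c x ≡ 1ℚ + ε · y x) (∣y∣≤B : ∀ x → ∣ y x ∣ ≤ B) where

  product-first-order : ∀ xs →
    ∣ foldr (λ x p → c x · p) 1ℚ xs - (1ℚ + ε · sum (map y xs)) ∣ ≤ ε · ε · remainderBound B (length xs)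
  product-first-order [] = ≤-reflexive
    (trans (cong ∣_∣ (solve 1 (λ e → con 1ℚ :- (con 1ℚ :+ e :* con 0ℚ) := con 0ℚ) refl ε)) (sym (*-zeroʳ (ε · ε))))
  product-first-order (x ∷ xs) = begin
    ∣ c x · P - (1ℚ + ε · (y x + s)) ∣
      ≡⟨ cong (λ t → ∣ t · P - (1ℚ + ε · (y x + s)) ∣) (c≡1+εy x) ⟩
    ∣ (1ℚ + ε · y x) · P - (1ℚ + ε · (y x + s)) ∣
      ≡⟨ cong ∣_∣ (solve 4 (λ e y s p → (con 1ℚ :+ e :* y) :* p :- (con 1ℚ :+ e :* (y :+ s))
                     := e :* e :* (y :* s) :+ (con 1ℚ :+ e :* y) :* (p :- (con 1ℚ :+ e :* s))) refl ε (y x) s P) ⟩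
    ∣ ε · ε · (y x · s) + (1ℚ + ε · y x) · r ∣
      ≤⟨ ∣p+q∣≤∣p∣+∣q∣ (ε · ε · (y x · s)) ((1ℚ + ε · y x) · r) ⟩
    ∣ ε · ε · (y x · s) ∣ + ∣ (1ℚ + ε · y x) · r ∣
      ≤⟨ +-mono-≤ quadratic linear ⟩
    ε · ε · (B · (fromℕ k · B)) + (1ℚ + B) · (ε · ε · K)
      ≡⟨ solve 4 (λ e b k K → e :* e :* (b :* (k :* b)) :+ (con 1ℚ :+ b) :* (e :* e :* K)
                     := e :* e :* (k :* b :* b :+ K :* (con 1ℚ :+ b))) refl ε B (fromℕ k) K ⟩
    ε · ε · remainderBound B (ℕ.suc k) ∎
    where
    open ≤-Reasoning
    k : ℕ
    k = length xs

    P s r K : ℚ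
    P = foldr (λ x p → c x · p) 1ℚ xs
    s = sum (map y xs)
    r = P - (1ℚ + ε · s)
    K = remainderBound B k

    0≤εε : 0ℚ ≤ ε · ε
    0≤εε = 0≤p·q 0≤ε 0≤ε

    quadratic : ∣ ε · ε · (y x · s) ∣ ≤ ε · ε · (B · (fromℕ k · B))
    quadratic = begin
      ∣ ε · ε · (y x · s) ∣         ≡⟨ ∣p*q∣≡∣p∣*∣q∣ (ε · ε) _ ⟩
      ∣ ε · ε ∣ · ∣ y x · s ∣       ≡⟨ cong₂ _·_ (0≤p⇒∣p∣≡p 0≤εε) (∣p*q∣≡∣p∣*∣q∣ (y x) s) ⟩
      ε · ε · (∣ y x ∣ · ∣ s ∣)     ≤⟨ *-monoˡ-≤-nonNeg (ε · ε) {{nonNegative 0≤εε}}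
                                        (*-mono-≤-nonNeg (0≤∣p∣ (y x)) (0≤∣p∣ s) (∣y∣≤B x) (∣sum-map∣≤ y ∣y∣≤B xs)) ⟩
      ε · ε · (B · (fromℕ k · B))   ∎

    ∣1+εy∣≤1+B : ∣ 1ℚ + ε · y x ∣ ≤ 1ℚ + B
    ∣1+εy∣≤1+B = begin
      ∣ 1ℚ + ε · y x ∣      ≤⟨ ∣p+q∣≤∣p∣+∣q∣ 1ℚ (ε · y x) ⟩
      1ℚ + ∣ ε · y x ∣      ≡⟨ cong (1ℚ +_) (trans (∣p*q∣≡∣p∣*∣q∣ ε (y x)) (cong (_· ∣ y x ∣) (0≤p⇒∣p∣≡p 0≤ε))) ⟩
      1ℚ + ε · ∣ y x ∣      ≤⟨ +-monoʳ-≤ 1ℚ (*-mono-≤-nonNeg 0≤ε (0≤∣p∣ (y x)) ε≤1 (∣y∣≤B x)) ⟩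
      1ℚ + 1ℚ · B           ≡⟨ cong (1ℚ +_) (*-identityˡ B) ⟩
      1ℚ + B                ∎

    linear : ∣ (1ℚ + ε · y x) · r ∣ ≤ (1ℚ + B) · (ε · ε · K)
    linear = ≤-trans (≤-reflexive (∣p*q∣≡∣p∣*∣q∣ (1ℚ + ε · y x) r))
      (*-mono-≤-nonNeg (0≤∣p∣ (1ℚ + ε · y x)) (0≤∣p∣ r) ∣1+εy∣≤1+B (product-first-order xs))

first-order-gain : ∀ {ε C D L X} → 0ℚ < ε → ε · C < 1ℚ → 1ℚ ≤ D →
                   ∣ X - (L + ε · D) ∣ ≤ ε · ε · C → L < X
first-order-gain {ε} {C} {D} {L} {X} 0<ε εC<1 1≤D ∣X-[L+εD]∣≤εεC = begin-strict
  L                                   ≡⟨ solve 2 (λ l e → l := l :+ e :* con 0ℚ) refl L ε ⟩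
  L + ε · 0ℚ                          <⟨ +-monoʳ-< L (*-monoʳ-<-pos ε {{positive 0<ε}} 0<D-εC) ⟩
  L + ε · (D - ε · C)                 ≡⟨ solve 4 (λ l e d c → l :+ e :* (d :- e :* c) := l :+ e :* d :- e :* e :* c) refl L ε D C ⟩
  L + ε · D - ε · ε · C               ≤⟨ +-monoʳ-≤ (L + ε · D) (neg-antimono-≤ ∣X-[L+εD]∣≤εεC) ⟩
  L + ε · D - ∣ X - (L + ε · D) ∣     ≤⟨ +-monoʳ-≤ (L + ε · D) (-∣p∣≤p (X - (L + ε · D))) ⟩
  L + ε · D + (X - (L + ε · D))       ≡⟨ solve 2 (λ q x → q :+ (x :- q) := x) refl (L + ε · D) X ⟩
  X                                   ∎
  where
  open ≤-Reasoning
  0<D-εC : 0ℚ < D - ε · C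
  0<D-εC = subst (_< D - ε · C) (+-inverseʳ (ε · C)) (+-monoˡ-< (- (ε · C)) (<-≤-trans εC<1 1≤D))

∃-small : ∀ C → 0ℚ ≤ C → ∃ λ ε → 0ℚ < ε × ε ≤ 1ℚ × (∀ {p} → p ≤ C → ε · p < 1ℚ)
∃-small C 0≤C = ε , positive⁻¹ ε {{1/pos⇒pos (1ℚ + C)}} , ε≤1 , ε·p<1
  where
  instance
    1+C-pos : Positive (1ℚ + C)
    1+C-pos = pos+nonNeg⇒pos 1ℚ C {{nonNegative 0≤C}}
    1+C-nonZero : NonZero (1ℚ + C)
    1+C-nonZero = pos⇒nonZero (1ℚ + C)

  ε : ℚ
  ε = 1/ (1ℚ + C)

  instance
    ε-nonNeg : NonNegative ε
    ε-nonNeg = pos⇒nonNeg ε {{1/pos⇒pos (1ℚ + C)}}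

  ε≤1 : ε ≤ 1ℚ
  ε≤1 = subst₂ _≤_ (*-identityʳ ε) (*-inverseˡ (1ℚ + C)) (*-monoˡ-≤-nonNeg ε (p≤p+q 0≤C))

  ε·p<1 : ∀ {p} → p ≤ C → ε · p < 1ℚ
  ε·p<1 p≤C = ≤-<-trans (*-monoˡ-≤-nonNeg ε p≤C)
    (subst (ε · C <_) (*-inverseˡ (1ℚ + C)) (*-monoʳ-<-pos ε {{1/pos⇒pos (1ℚ + C)}} C<1+C))
    where
    C<1+C : C < 1ℚ + C
    C<1+C = subst (_< 1ℚ + C) (+-identityˡ C) (+-monoˡ-< C (positive⁻¹ 1ℚ))

sumOver : ∀ {m} → Subset m → (Fin m → ℚ) → ℚ
sumOver {m} T x = sum (map (λ e → 𝟙 (lookup T e) · x e) (allFin m))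

-- The derivative of ε ↦ τ(1 + ε x) at ε = 0.
τ′ : ∀ {m} → List (Subset m) → (Fin m → ℚ) → ℚ
τ′ Ts x = sum (map (λ T → sumOver T x) Ts)

module _ {n m : ℕ} (G : Graph n m) where

  τ-const-1 : ∀ Ts → τ G Ts (λ _ → 1ℚ) ≡ fromℕ (length Ts)
  τ-const-1 Ts = trans (cong sum (map-cong (λ T → product-1 T (allFin m)) Ts)) (sum-map-1 Ts)
    where
    product-1 : ∀ T es → foldr (λ e p → (if lookup T e then 1ℚ else 1ℚ) · p) 1ℚ es ≡ 1ℚ
    product-1 T []       = refl
    product-1 T (e ∷ es) = cong₂ _·_ (if-eta (lookup T e)) (product-1 T es)

  τ-first-order : ∀ Ts {ε B} (f x : Fin m → ℚ) → 0ℚ ≤ ε → ε ≤ 1ℚ →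
                  (∀ e → ∣ x e ∣ ≤ B) → (∀ e → f e ≡ 1ℚ + ε · x e) →
                  ∣ τ G Ts f - (fromℕ (length Ts) + ε · τ′ Ts x) ∣ ≤ ε · ε · (fromℕ (length Ts) · remainderBound B m)
  τ-first-order Ts {ε} {B} f x 0≤ε ε≤1 ∣x∣≤B f≡1+εx = begin
    ∣ τ G Ts f - (L + ε · τ′ Ts x) ∣
      ≡⟨ cong (λ t → ∣ τ G Ts f - t ∣) (sym (sum-map-1+· ε (λ T → sumOver T x) Ts)) ⟩
    ∣ τ G Ts f - sum (map (λ T → 1ℚ + ε · sumOver T x) Ts) ∣
      ≡⟨ cong ∣_∣ (sym (sum-map-- (prodOver G f) _ Ts)) ⟩
    ∣ sum (map (λ T → prodOver G f T - (1ℚ + ε · sumOver T x)) Ts) ∣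
      ≤⟨ ∣sum-map∣≤ _ product-first-order-over Ts ⟩
    L · (ε · ε · remainderBound B m)
      ≡⟨ solve 3 (λ l e r → l :* (e :* e :* r) := e :* e :* (l :* r)) refl L ε (remainderBound B m) ⟩
    ε · ε · (L · remainderBound B m) ∎
    where
    open ≤-Reasoning
    L : ℚ
    L = fromℕ (length Ts)

    factor : ∀ t e → (if t then f e else 1ℚ) ≡ 1ℚ + ε · (𝟙 t · x e)
    factor true  e = trans (f≡1+εx e) (cong (λ p → 1ℚ + ε · p) (sym (*-identityˡ (x e))))
    factor false e = solve 2 (λ e x → con 1ℚ := con 1ℚ :+ e :* (con 0ℚ :* x)) refl ε (x e)

    product-first-order-over : ∀ T → ∣ prodOver G f T - (1ℚ + ε · sumOver T x) ∣ ≤ ε · ε · remainderBound B m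
    product-first-order-over T =
      subst (λ k → ∣ prodOver G f T - (1ℚ + ε · sumOver T x) ∣ ≤ ε · ε · remainderBound B k) (length-tabulate {n = m} id)
      (product-first-order 0≤ε ε≤1 (λ e → if lookup T e then f e else 1ℚ) (λ e → 𝟙 (lookup T e) · x e)
        (λ e → factor (lookup T e) e) (λ e → ≤-trans (∣𝟙·p∣≤∣p∣ (lookup T e) (x e)) (∣x∣≤B e)) (allFin m))

  𝟙-endpoints : ∀ e u → 𝟙 (does (proj₁ (ends G e) Fin.≟ u)) + 𝟙 (does (proj₂ (ends G e) Fin.≟ u)) ≡ 𝟙 (incident G u e)
  𝟙-endpoints e u with proj₁ (ends G e) Fin.≟ u | proj₂ (ends G e) Fin.≟ u
  ... | yes e₁≡u | yes e₂≡u = ⊥-elim (loopless G e (trans e₁≡u (sym e₂≡u)))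
  ... | yes _    | no _     = refl
  ... | no _     | yes _    = refl
  ... | no _     | no _     = refl

  deg-as-sum : ∀ u → fromℕ (deg G u) ≡ sum (map (λ e → 𝟙 (incident G u e)) (allFin m))
  deg-as-sum u = sym (sum-map-𝟙 (incident G u) (allFin m))

  degIn-as-sumOver : ∀ T u → fromℕ (degIn G T u) ≡ sumOver T (λ e → 𝟙 (incident G u e))
  degIn-as-sumOver T u = trans (cong fromℕ degIn-filters-P)
    (trans (sym (sum-map-𝟙 P (allFin m))) (cong sum (map-cong 𝟙-P (allFin m))))
    where
    -- The predicate filtered by `degIn`, found by unification: its conjunction is local to Defs.
    P : Fin m → Bool
    P = _

    degIn-filters-P : degIn G T u ≡ length (filter (λ e → P e Bool.≟ true) (allFin m))
    degIn-filters-P = refl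

    𝟙-P : ∀ e → 𝟙 (P e) ≡ 𝟙 (lookup T e) · 𝟙 (incident G u e)
    𝟙-P e with incident G u e | lookup T e
    ... | true  | t = sym (*-identityʳ (𝟙 t))
    ... | false | t = sym (*-zeroʳ (𝟙 t))

module VertexPerturbation {n m : ℕ} (G : Graph n m) (v w : Fin n) where

  a b : ℚ
  a = fromℕ (deg G w)
  b = fromℕ (deg G v)

  δ : Fin n → Fin n → ℚ
  δ u z = 𝟙 (does (u Fin.≟ z))

  h : Fin n → ℚ
  h u = a · δ u v - b · δ u w

  x : Fin m → ℚ
  x e = a · 𝟙 (incident G v e) - b · 𝟙 (incident G w e)

  h+h≡x : ∀ e → h (proj₁ (ends G e)) + h (proj₂ (ends G e)) ≡ x e
  h+h≡x e = trans
    (solve 6 (λ a b p q r s → a :* p :- b :* q :+ (a :* r :- b :* s) := a :* (p :+ r) :- b :* (q :+ s))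
       refl a b (δ (proj₁ (ends G e)) v) (δ (proj₁ (ends G e)) w) (δ (proj₂ (ends G e)) v) (δ (proj₂ (ends G e)) w))
    (cong₂ (λ p q → a · p - b · q) (𝟙-endpoints G e v) (𝟙-endpoints G e w))

  sum-x≡0 : sum (map x (allFin m)) ≡ 0ℚ
  sum-x≡0 = begin
    sum (map x (allFin m))
      ≡⟨ sum-map-linear a b _ _ (allFin m) ⟩
    a · sum (map (λ e → 𝟙 (incident G v e)) (allFin m)) - b · sum (map (λ e → 𝟙 (incident G w e)) (allFin m))
      ≡⟨ cong₂ (λ p q → a · p - b · q) (sym (deg-as-sum G v)) (sym (deg-as-sum G w)) ⟩
    a · b - b · a
      ≡⟨ solve 2 (λ a b → a :* b :- b :* a := con 0ℚ) refl a b ⟩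
    0ℚ ∎
    where open ≡-Reasoning

  0≤a : 0ℚ ≤ a
  0≤a = fromℕ-nonNeg (deg G w)

  0≤b : 0ℚ ≤ b
  0≤b = fromℕ-nonNeg (deg G v)

  ∣x∣≤a+b : ∀ e → ∣ x e ∣ ≤ a + b
  ∣x∣≤a+b e = ≤-trans (∣p-q∣≤∣p∣+∣q∣ (a · 𝟙 (incident G v e)) (b · 𝟙 (incident G w e)))
    (+-mono-≤ (∣·𝟙∣≤ 0≤a (incident G v e)) (∣·𝟙∣≤ 0≤b (incident G w e)))
    where
    ∣·𝟙∣≤ : ∀ {p} → 0ℚ ≤ p → ∀ t → ∣ p · 𝟙 t ∣ ≤ p
    ∣·𝟙∣≤ 0≤p t = subst (_≤ _) (sym (0≤p⇒∣p∣≡p (0≤p·q 0≤p (0≤𝟙 t)))) (·𝟙≤ 0≤p t)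

  -b≤h : ∀ u → - b ≤ h u
  -b≤h u = subst (_≤ h u) (+-identityˡ (- b))
    (+-mono-≤ (0≤p·q 0≤a (0≤𝟙 (does (u Fin.≟ v)))) (neg-antimono-≤ {b · δ u w} {b} (·𝟙≤ 0≤b (does (u Fin.≟ w)))))

  vertexWeight : ℚ → Fin n → ℚ
  vertexWeight ε u = ½ + ε · h u

  valuation : ℚ → Fin m → ℚ
  valuation ε e = vertexWeight ε (proj₁ (ends G e)) + vertexWeight ε (proj₂ (ends G e))

  valuation≡1+εx : ∀ ε e → valuation ε e ≡ 1ℚ + ε · x e
  valuation≡1+εx ε e = trans
    (solve 3 (λ ε p q → con ½ :+ ε :* p :+ (con ½ :+ ε :* q) := con 1ℚ :+ ε :* (p :+ q))
       refl ε (h (proj₁ (ends G e))) (h (proj₂ (ends G e))))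
    (cong (λ p → 1ℚ + ε · p) (h+h≡x e))

  vertexWeight-pos : ∀ {ε} → 0ℚ ≤ ε → ε · (b + b) < 1ℚ → ∀ u → 0ℚ < vertexWeight ε u
  vertexWeight-pos {ε} 0≤ε ε[b+b]<1 u = begin-strict
    0ℚ                         ≡⟨ sym (*-zeroʳ ½) ⟩
    ½ · 0ℚ                     <⟨ *-monoʳ-<-pos ½ 0<1-ε[b+b] ⟩
    ½ · (1ℚ - ε · (b + b))     ≡⟨ solve 2 (λ ε b → con ½ :* (con 1ℚ :- ε :* (b :+ b)) := con ½ :+ ε :* (:- b)) refl ε b ⟩
    ½ + ε · (- b)              ≤⟨ +-monoʳ-≤ ½ (*-monoˡ-≤-nonNeg ε {{nonNegative 0≤ε}} (-b≤h u)) ⟩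
    ½ + ε · h u                ∎
    where
    open ≤-Reasoning
    0<1-ε[b+b] : 0ℚ < 1ℚ - ε · (b + b)
    0<1-ε[b+b] = subst (_< 1ℚ - ε · (b + b)) (+-inverseʳ (ε · (b + b))) (+-monoˡ-< (- (ε · (b + b))) ε[b+b]<1)

  valuation-InC : ∀ {ε} → 0ℚ ≤ ε → ε · (b + b) < 1ℚ → InC G (valuation ε)
  valuation-InC {ε} 0≤ε ε[b+b]<1 = (valuation-pos , sum-valuation) , vertexWeight ε , pos , λ _ → refl
    where
    pos : ∀ u → 0ℚ < vertexWeight ε u
    pos = vertexWeight-pos 0≤ε ε[b+b]<1

    valuation-pos : ∀ e → 0ℚ < valuation ε e
    valuation-pos e = +-mono-< (pos (proj₁ (ends G e))) (pos (proj₂ (ends G e)))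

    sum-valuation : sum (map (valuation ε) (allFin m)) ≡ fromℕ m
    sum-valuation = begin
      sum (map (valuation ε) (allFin m))
        ≡⟨ cong sum (map-cong (valuation≡1+εx ε) (allFin m)) ⟩
      sum (map (λ e → 1ℚ + ε · x e) (allFin m))
        ≡⟨ sum-map-1+· ε x (allFin m) ⟩
      fromℕ (length (allFin m)) + ε · sum (map x (allFin m))
        ≡⟨ cong₂ (λ k s → fromℕ k + ε · s) (length-tabulate {n = m} id) sum-x≡0 ⟩
      fromℕ m + ε · 0ℚ
        ≡⟨ solve 2 (λ k ε → k :+ ε :* con 0ℚ := k) refl (fromℕ m) ε ⟩
      fromℕ m ∎
      where open ≡-Reasoning

  sumOver-x : ∀ T → sumOver T x ≡ a · fromℕ (degIn G T v) - b · fromℕ (degIn G T w)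
  sumOver-x T = begin
    sumOver T x
      ≡⟨ cong sum (map-cong distribute (allFin m)) ⟩
    sum (map (λ e → a · 𝟙v e - b · 𝟙w e) (allFin m))
      ≡⟨ sum-map-linear a b 𝟙v 𝟙w (allFin m) ⟩
    a · sumOver T (λ e → 𝟙 (incident G v e)) - b · sumOver T (λ e → 𝟙 (incident G w e))
      ≡⟨ cong₂ (λ p q → a · p - b · q) (sym (degIn-as-sumOver G T v)) (sym (degIn-as-sumOver G T w)) ⟩
    a · fromℕ (degIn G T v) - b · fromℕ (degIn G T w) ∎
    where
    open ≡-Reasoning
    𝟙v 𝟙w : Fin m → ℚ
    𝟙v e = 𝟙 (lookup T e) · 𝟙 (incident G v e)
    𝟙w e = 𝟙 (lookup T e) · 𝟙 (incident G w e)
    distribute : ∀ e → 𝟙 (lookup T e) · x e ≡ a · 𝟙v e - b · 𝟙w e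
    distribute e = solve 5 (λ t a b p q → t :* (a :* p :- b :* q) := a :* (t :* p) :- b :* (t :* q))
      refl (𝟙 (lookup T e)) a b (𝟙 (incident G v e)) (𝟙 (incident G w e))

  τ′-x : ∀ Ts → τ′ Ts x ≡ fromℕ (dT G Ts v * deg G w) - fromℕ (dT G Ts w * deg G v)
  τ′-x Ts = begin
    τ′ Ts x
      ≡⟨ cong sum (map-cong sumOver-x Ts) ⟩
    sum (map (λ T → a · fromℕ (degIn G T v) - b · fromℕ (degIn G T w)) Ts)
      ≡⟨ sum-map-linear a b _ _ Ts ⟩
    a · sum (map (λ T → fromℕ (degIn G T v)) Ts) - b · sum (map (λ T → fromℕ (degIn G T w)) Ts)
      ≡⟨ cong₂ (λ p q → a · p - b · q) (sum-map-fromℕ _ Ts) (sum-map-fromℕ _ Ts) ⟩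
    a · fromℕ (dT G Ts v) - b · fromℕ (dT G Ts w)
      ≡⟨ cong₂ _-_ (trans (*-comm a _) (sym (fromℕ-* (dT G Ts v) (deg G w))))
                   (trans (*-comm b _) (sym (fromℕ-* (dT G Ts w) (deg G v)))) ⟩
    fromℕ (dT G Ts v * deg G w) - fromℕ (dT G Ts w * deg G v) ∎
    where open ≡-Reasoning

module _ {n m : ℕ} (G : Graph n m) (Ts : List (Subset m)) (v w : Fin n) where
  open VertexPerturbation G v w

  valuation-beats-1 : ∀ {ε} → 0ℚ < ε → ε ≤ 1ℚ → ε · (fromℕ (length Ts) · remainderBound (a + b) m) < 1ℚ →
                      dT G Ts w * deg G v ℕ.< dT G Ts v * deg G w → τ G Ts (λ _ → 1ℚ) < τ G Ts (valuation ε)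
  valuation-beats-1 {ε} 0<ε ε≤1 small lt = subst (_< τ G Ts (valuation ε)) (sym (τ-const-1 G Ts))
    (first-order-gain 0<ε small (subst (1ℚ ≤_) (sym (τ′-x Ts)) (fromℕ-<⇒1≤- lt))
      (τ-first-order G Ts (valuation ε) x (<⇒≤ 0<ε) ε≤1 ∣x∣≤a+b (valuation≡1+εx ε)))

  private
    0≤b+b : 0ℚ ≤ b + b
    0≤b+b = +-mono-≤ 0≤b 0≤b

    0≤LK : 0ℚ ≤ fromℕ (length Ts) · remainderBound (a + b) m
    0≤LK = 0≤p·q (fromℕ-nonNeg (length Ts)) (remainderBound-nonNeg (+-mono-≤ 0≤a 0≤b) m)

  constant-valuation-not-maximal : dT G Ts w * deg G v ℕ.< dT G Ts v * deg G w →
                                   ∃ λ f → InC G f × τ G Ts (λ _ → 1ℚ) < τ G Ts f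
  constant-valuation-not-maximal lt =
    let ε , 0<ε , ε≤1 , ε·p<1 = ∃-small (b + b + fromℕ (length Ts) · remainderBound (a + b) m) (+-mono-≤ 0≤b+b 0≤LK)
    in valuation ε , valuation-InC (<⇒≤ 0<ε) (ε·p<1 (p≤p+q 0≤LK)) , valuation-beats-1 0<ε ε≤1 (ε·p<1 (q≤p+q 0≤b+b)) lt

corollary1 : ∀ {n m : ℕ} (G : Graph n m) → Connected G →
    (Ts : List (Subset m)) → TreeEnumeration G Ts →
    (∀ (f : Fin m → ℚ) → InC G f → τ G Ts f ≤ τ G Ts (λ _ → 1ℚ)) →
    ∀ (v w : Fin n) → dT G Ts v * deg G w ≡ dT G Ts w * deg G v
corollary1 G _ Ts _ maximal v w = ℕₚ.≤-antisym (ℕₚ.≮⇒≥ (not-< v w)) (ℕₚ.≮⇒≥ (not-< w v))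
  where
  not-< : ∀ v w → ¬ (dT G Ts w * deg G v ℕ.< dT G Ts v * deg G w)
  not-< v w lt =
    let f , f∈C , τ1<τf = constant-valuation-not-maximal G Ts v w lt
    in <-irrefl refl (<-≤-trans τ1<τf (maximal f f∈C))
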